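{- Let $D$ be a semicomplete multipartite digraph containing a G-cycle factor consisting of exactly two G-cycles $C_1^g$ and $C_2^g$. Suppose that $C_1^g$ contains a vertex singular with respect to $C_2^g$, that $C_2^g$ contains a vertex singular with respect to $C_1^g$, and that neither $C_1^g\simeq> C_2^g$ nor $C_2^g\simeq> C_1^g$ holds. Then $D$ has a spanning G-cycle with at least $\ell(C_1^g)+\ell(C_2^g)$ arcs.
   Context: All digraphs are finite, without loops or parallel arcs (2-cycles allowed). A digraph $D$ is a semicomplete multipartite digraph if $V(D)$ has a partition into nonempty sets (partite sets) such that no arc has both ends in the same set and any two vertices in different partite sets are joined by at least one arc. A G-cycle of $D$ is either a directed cycle of $D$, or a sequence of $r\ge1$ pairwise vertex-disjoint directed paths $P_1,\ldots,P_r$ of $D$ (a path may be a single vertex), $P_i$ from $u_i$ to $v_i$, such that $v_i$ and $u_{i+1}$ lie in the same partite set for every $i\in[r]$, where $u_{r+1}=u_1$. Its length $\ell$ (number of arcs) is the number of arcs of $D$ it uses; it is spanning if it contains all vertices of $D$. A G-cycle factor is a collection of pairwise vertex-disjoint G-cycles covering all vertices of $D$. For a G-cycle $C^g$ and a vertex $v\notin V(C^g)$: $v$ is out-singular with respect to $C^g$ if there is no arc from $V(C^g)$ to $v$; $v$ is in-singular with respect to $C^g$ if there is no arc from $v$ to $V(C^g)$; $v$ is singular if it is out-singular or in-singular. For vertex-disjoint G-cycles $C_1^g,C_2^g$, $C_1^g\simeq> C_2^g$ means: $C_1^g$ contains at least one vertex singular with respect to $C_2^g$ and all such vertices are out-singular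 with respect to $C_2^g$, and $C_2^g$ contains at least one vertex singular with respect to $C_1^g$ and all such vertices are in-singular with respect to $C_1^g$. -}

module Defs where

open import Level using (0ℓ)
open import Data.Nat using (ℕ; _+_; _∸_)
open import Data.Fin using (Fin)
open import Data.List using (List; []; _∷_; _++_; [_]; concat; map; length)
open import Data.Nat.ListAction using (sum)
open import Data.List.NonEmpty as L⁺ using (List⁺; _∷_; toList)
open import Data.List.Relation.Unary.Linked using (Linked)
open import Data.List.Relation.Unary.Unique.Propositional using (Unique)
open import Data.List.Membership.Propositional using (_∈_; _∉_)
open import Data.Product using (Σ; ∃; _×_)
open import Data.Sum using (_⊎_)
open import Data.Empty using (⊥)
open import Relation.Nullary using (¬_)
open import Relation.Binary.PropositionalEquality using (_≡_; _≢_)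

-- A digraph on vertex set Fin n: an arc relation without loops.
-- (Being a relation, there are no parallel arcs; 2-cycles are allowed.)
record Digraph : Set₁ where
  field
    n     : ℕ
    _⇒_   : Fin n → Fin n → Set
    loopless : ∀ v → ¬ (v ⇒ v)

record SMD : Set₁ where
  field
    G : Digraph
  open Digraph G public
  field
    k        : ℕ
    part     : Fin n → Fin k
    nonempty : ∀ (i : Fin k) → ∃ λ v → part v ≡ i
    indep    : ∀ u v → part u ≡ part v → ¬ (u ⇒ v)
    complete : ∀ u v → part u ≢ part v → (u ⇒ v) ⊎ (v ⇒ u)

module _ (D : SMD) where
  open SMD D

  IsPath : List⁺ (Fin n) → Set
  IsPath p = Unique (toList p) × Linked _⇒_ (toList p)

  IsDirCycle : List⁺ (Fin n) → Set
  IsDirCycle (v ∷ ws) = Unique (v ∷ ws) × Linked _⇒_ (v ∷ ws ++ [ v ])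

  IsPathSeq : List⁺ (List⁺ (Fin n)) → Set
  IsPathSeq (p ∷ ps) =
    Data.List.Relation.Unary.All.All IsPath (p ∷ ps)
    × Unique (concat (map toList (p ∷ ps)))
    × Linked (λ P Q → part (L⁺.last P) ≡ part (L⁺.head Q)) (p ∷ ps ++ [ p ])
    where import Data.List.Relation.Unary.All

  data GCycle : Set where
    dircycle : (c : List⁺ (Fin n)) → IsDirCycle c → GCycle
    pathseq  : (ps : List⁺ (List⁺ (Fin n))) → IsPathSeq ps → GCycle

  V : GCycle → List (Fin n)
  V (dircycle c _) = toList c
  V (pathseq ps _) = concat (map toList (toList ps))

  len : GCycle → ℕ
  len (dircycle c _) = L⁺.length c
  len (pathseq ps _) = sum (map (λ p → L⁺.length p ∸ 1) (toList ps))

  OutSingular : GCycle → Fin n → Set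
  OutSingular C v = v ∉ V C × (∀ u → u ∈ V C → ¬ (u ⇒ v))

  InSingular : GCycle → Fin n → Set
  InSingular C v = v ∉ V C × (∀ u → u ∈ V C → ¬ (v ⇒ u))

  Singular : GCycle → Fin n → Set
  Singular C v = OutSingular C v ⊎ InSingular C v

  HasSingular : GCycle → GCycle → Set
  HasSingular C₁ C₂ = ∃ λ v → v ∈ V C₁ × Singular C₂ v

  _≃>_ : GCycle → GCycle → Set
  C₁ ≃> C₂ =
    HasSingular C₁ C₂
    × (∀ v → v ∈ V C₁ → Singular C₂ v → OutSingular C₂ v)
    × HasSingular C₂ C₁
    × (∀ v → v ∈ V C₂ → Singular C₁ v → InSingular C₁ v)

  IsFactor₂ : GCycle → GCycle → Set
  IsFactor₂ C₁ C₂ =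
    (∀ v → v ∈ V C₁ → v ∈ V C₂ → ⊥) × (∀ v → v ∈ V C₁ ⊎ v ∈ V C₂)

  Spanning : GCycle → Set
  Spanning C = ∀ v → v ∈ V C

{-# OPTIONS --safe #-}
-- Read a G-cycle as a cyclic sequence of distinct vertices in which every step is an arc or stays
-- inside a partite set; its length is then the number of steps that change partite set. Two
-- disjoint such sequences X, Y are spliced by cutting X after x′ and Y after y′ and reconnecting
-- x′ to the successor of y′ and y′ to the successor of x′. If x′ and y′ (or their successors) lie
-- in one partite set, the number of changes of partite set is preserved, so the result is a
-- spanning G-cycle of length ℓ(C₁) + ℓ(C₂). Splicing after out-singular vertices a ∈ C₁, b ∈ C₂
-- works: a, b are non-adjacent, hence in one partite set, and the new steps a → succ b, b → succ a
-- cannot be reversed arcs. Dually, splicing before in-singular vertices works. So the only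
-- obstruction is that all singular vertices of C₁ are of one kind and all of C₂ of the other,
-- which is C₁ ≃> C₂ or C₂ ≃> C₁.
module Submission where

open import Defs
open import Level using (0ℓ)
open import Data.Nat using (ℕ; suc; _+_; _∸_; _≥_)
open import Data.Nat.Properties using (+-comm; +-assoc; +-identityʳ; ≤-reflexive; +-commutativeSemigroup)
open import Algebra.Properties.CommutativeSemigroup +-commutativeSemigroup using (interchange)
open import Data.Nat.ListAction using (sum)
open import Data.Bool using (if_then_else_)
open import Data.Fin using (Fin)
open import Data.Fin.Properties using (_≟_)
open import Data.List as List using (List; []; _∷_; _++_; [_]; concat; map; length)
open import Data.List.Properties using (++-identityʳ)
open import Data.List.NonEmpty as L⁺ using (List⁺; _∷_; toList)
open import Data.List.Relation.Unary.Linked as Linked using (Linked; [-]; _∷_)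
open import Data.List.Relation.Unary.All as All using (All; []; _∷_)
import Data.List.Relation.Unary.All.Properties as All
open import Data.List.Relation.Unary.Unique.Propositional using (Unique; []; _∷_)
import Data.List.Relation.Unary.Unique.Propositional.Properties as Unique
open import Data.List.Relation.Binary.Disjoint.Propositional using (Disjoint)
open import Data.List.Relation.Unary.Any using (here; there)
open import Data.List.Membership.Propositional using (_∈_)
open import Data.List.Membership.Propositional.Properties using (∈-∃++; ∈-++⁺ˡ; ∈-++⁺ʳ)
open import Data.List.Relation.Binary.Permutation.Propositional using (_↭_; ↭-refl; ↭-sym; ↭-trans; ↭⇒↭ₛ)
open import Data.List.Relation.Binary.Permutation.Propositional.Properties using (∈-resp-↭; ++-comm; ++⁺)
import Data.List.Relation.Binary.Permutation.Setoid.Properties as ↭ₛ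
open import Data.Product as Product using (Σ-syntax; ∃; ∃₂; _×_; _,_; proj₁; proj₂)
open import Data.Sum as Sum using (_⊎_; inj₁; inj₂; [_,_]′)
open import Function using (case_of_)
import Data.Sum.Effectful.Left as Sumₗ
open import Relation.Nullary using (¬_; yes; no; does; contradiction)
open import Relation.Nullary.Decidable using (dec-true; dec-false; decidable-stable)
open import Relation.Binary.PropositionalEquality as ≡ using (_≡_; refl; sym; trans; cong; cong₂; subst)

module _ {A : Set} where

  -- final x xs is L⁺.last (x ∷ xs) (see last≡end), but reduces by structural recursion.
  final : A → List A → A
  final x []       = x
  final _ (y ∷ ys) = final y ys

  end : List⁺ A → A
  end (x ∷ xs) = final x xs

  final-++ : ∀ x xs y ys → final x (xs ++ y ∷ ys) ≡ final y ys
  final-++ x []       y ys = refl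
  final-++ _ (z ∷ xs) y ys = final-++ z xs y ys

  final-cong : ∀ {B : Set} (f : A → B) {x y} xs → f x ≡ f y → f (final x xs) ≡ f (final y xs)
  final-cong f []       e = e
  final-cong f (_ ∷ _)  _ = refl

  final∈ : ∀ x xs → final x xs ∈ x ∷ xs
  final∈ x []       = here refl
  final∈ _ (y ∷ ys) = there (final∈ y ys)

  last≡end : ∀ xs → L⁺.last xs ≡ end xs
  last≡end (x ∷ xs) with List.initLast xs
  ... | []              = refl
  ... | ys List.∷ʳ′ y   = sym (final-++ x ys y [])

  Unique-++⁻ : ∀ xs {ys : List A} → Unique (xs ++ ys) → Unique xs × Unique ys
  Unique-++⁻ []       u        = [] , u
  Unique-++⁻ (x ∷ xs) (x∉ ∷ u) = Product.map₁ (All.++⁻ˡ xs x∉ ∷_) (Unique-++⁻ xs u)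

  Unique-resp-↭ : ∀ {xs ys : List A} → xs ↭ ys → Unique xs → Unique ys
  Unique-resp-↭ p = ↭ₛ.Unique-resp-↭ (≡.setoid A) (↭⇒↭ₛ p)

  forEach : ∀ {B : A → Set} {G : Set} xs → (∀ {x} → x ∈ xs → G ⊎ B x) → G ⊎ (∀ x → x ∈ xs → B x)
  forEach xs f =
    Sum.map₂ (λ all x x∈ → All.lookup all x∈) (All.sequenceA 0ℓ (Sumₗ.applicative _ 0ℓ) (All.tabulate f))

  module _ {R : A → A → Set} where

    Linked-head : ∀ {x y xs} → (∀ {z} → R x z → R y z) → Linked R (x ∷ xs) → Linked R (y ∷ xs)
    Linked-head f [-]     = [-]
    Linked-head f (r ∷ l) = f r ∷ l

    Linked-join : ∀ {x xs y ys} → Linked R (x ∷ xs) → R (final x xs) y → Linked R (y ∷ ys) →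
                  Linked R (x ∷ xs ++ y ∷ ys)
    Linked-join [-]      r l = r ∷ l
    Linked-join (r′ ∷ k) r l = r′ ∷ Linked-join k r l

    Linked-split : ∀ {x} xs {y ys} → Linked R (x ∷ xs ++ y ∷ ys) →
                   Linked R (x ∷ xs) × R (final x xs) y × Linked R (y ∷ ys)
    Linked-split []       (r ∷ l) = [-] , r , l
    Linked-split (_ ∷ xs) (r ∷ l) = Product.map₁ (r ∷_) (Linked-split xs l)

  module _ (f : A → A → ℕ) where

    sumSteps : List A → ℕ
    sumSteps (x ∷ y ∷ xs) = f x y + sumSteps (y ∷ xs)
    sumSteps _            = 0

    sumSteps-++ : ∀ x xs y ys →
                  sumSteps (x ∷ xs ++ y ∷ ys) ≡ sumSteps (x ∷ xs) + (f (final x xs) y + sumSteps (y ∷ ys))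
    sumSteps-++ x []       y ys = refl
    sumSteps-++ x (z ∷ xs) y ys =
      trans (cong (f x z +_) (sumSteps-++ z xs y ys)) (sym (+-assoc (f x z) (sumSteps (z ∷ xs)) _))

    sumSteps-Linked : ∀ {R : A → A → Set} {x xs} → (∀ {y z} → R y z → f y z ≡ 1) →
                      Linked R (x ∷ xs) → sumSteps (x ∷ xs) ≡ length xs
    sumSteps-Linked one [-]     = refl
    sumSteps-Linked one (r ∷ l) = cong₂ _+_ (one r) (sumSteps-Linked one l)

    sumSteps-cycle : ∀ x xs y ys →
                     sumSteps (x ∷ xs ++ y ∷ ys) + f (final x (xs ++ y ∷ ys)) x
                     ≡ (sumSteps (x ∷ xs) + f (final x xs) y) + (sumSteps (y ∷ ys) + f (final y ys) x)
    sumSteps-cycle x xs y ys rewrite sumSteps-++ x xs y ys | final-++ x xs y ys =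
      trans (cong (_+ f (final y ys) x) (sym (+-assoc (sumSteps (x ∷ xs)) _ _)))
            (+-assoc (sumSteps (x ∷ xs) + f (final x xs) y) _ _)

module _ (D : SMD) where
  open SMD D

  data Step (u v : Fin n) : Set where
    arc : u ⇒ v → Step u v
    gap : part u ≡ part v → Step u v

  step? : ∀ u v → Step u v ⊎ v ⇒ u
  step? u v with part u ≟ part v
  ... | yes same = inj₁ (gap same)
  ... | no differ = Sum.map₁ arc (complete u v differ)

  nonadjacent⇒samePart : ∀ {u v} → ¬ u ⇒ v → ¬ v ⇒ u → part u ≡ part v
  nonadjacent⇒samePart {u} {v} ¬u⇒v ¬v⇒u =
    decidable-stable (part u ≟ part v) (λ differ → [ ¬u⇒v , ¬v⇒u ]′ (complete u v differ))

  crosses : Fin n → Fin n → ℕ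
  crosses u v = if does (part u ≟ part v) then 0 else 1

  crosses-arc : ∀ {u v} → u ⇒ v → crosses u v ≡ 1
  crosses-arc {u} {v} u⇒v rewrite dec-false (part u ≟ part v) (λ same → indep u v same u⇒v) = refl

  crosses-gap : ∀ {u v} → part u ≡ part v → crosses u v ≡ 0
  crosses-gap {u} {v} same rewrite dec-true (part u ≟ part v) same = refl

  crosses-cong : ∀ {a a′ b b′} → part a ≡ part a′ → part b ≡ part b′ → crosses a b ≡ crosses a′ b′
  crosses-cong = cong₂ (λ i j → if does (i ≟ j) then 0 else 1)

  crosses-exchange : ∀ {a b x y} → part a ≡ part b ⊎ part x ≡ part y →
                     crosses a y + crosses b x ≡ crosses a x + crosses b y
  crosses-exchange {a} {b} {x} {y} (inj₁ a∼b) =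
    trans (cong₂ _+_ (crosses-cong a∼b refl) (crosses-cong (sym a∼b) refl))
          (+-comm (crosses b y) (crosses a x))
  crosses-exchange (inj₂ x∼y) = cong₂ _+_ (crosses-cong refl (sym x∼y)) (crosses-cong refl x∼y)

  crossings : List (Fin n) → ℕ
  crossings = sumSteps crosses

  cycle-weight-arcs : ∀ {x xs} → Linked _⇒_ (x ∷ xs) → final x xs ⇒ x →
                      crossings (x ∷ xs) + crosses (final x xs) x ≡ suc (length xs)
  cycle-weight-arcs {xs = xs} arcs back
    rewrite sumSteps-Linked crosses crosses-arc arcs | crosses-arc back = +-comm (length xs) 1

  cycle-weight-gap : ∀ x xs → part (final x xs) ≡ part x →
                     crossings (x ∷ xs) + crosses (final x xs) x ≡ crossings (x ∷ xs)
  cycle-weight-gap x xs same = trans (cong (crossings (x ∷ xs) +_) (crosses-gap same)) (+-identityʳ _)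

  record Circuit : Set where
    constructor circuit
    field
      first    : Fin n
      rest     : List (Fin n)
      distinct : Unique (first ∷ rest)
      steps    : Linked Step (first ∷ rest)
      closing  : Step (final first rest) first

    vertices : List (Fin n)
    vertices = first ∷ rest

    last : Fin n
    last = final first rest

    weight : ℕ
    weight = crossings (first ∷ rest) + crosses last first

  open Circuit

  record Traces (c : Circuit) (vs : List (Fin n)) (ℓ : ℕ) : Set where
    constructor traces
    field
      vertices↭ : vertices c ↭ vs
      weight≡   : weight c ≡ ℓ

  record _≈_ (c c′ : Circuit) : Set where
    constructor mk≈
    field
      vertices↭ : vertices c ↭ vertices c′
      weight≡   : weight c ≡ weight c′

  ≈-sym : ∀ {c c′} → c ≈ c′ → c′ ≈ c
  ≈-sym (mk≈ p w) = mk≈ (↭-sym p) (sym w)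

  Traces-resp-≈ : ∀ {c c′ vs ℓ} → c ≈ c′ → Traces c′ vs ℓ → Traces c vs ℓ
  Traces-resp-≈ (mk≈ p w) (traces p′ w′) = traces (↭-trans p p′) (trans w w′)

  first∈ : ∀ {c vs ℓ} → Traces c vs ℓ → first c ∈ vs
  first∈ (traces p _) = ∈-resp-↭ p (here refl)

  last∈ : ∀ {c vs ℓ} → Traces c vs ℓ → last c ∈ vs
  last∈ {c} (traces p _) = ∈-resp-↭ p (final∈ (first c) (rest c))

  rotate : (c : Circuit) → ∀ {t₁ b t₂} → rest c ≡ t₁ ++ b ∷ t₂ →
           Σ[ c′ ∈ Circuit ] first c′ ≡ b × last c′ ≡ final (first c) t₁ × c′ ≈ c
  rotate (circuit h _ u s h←) {t₁} {b} {t₂} refl with Linked-split t₁ s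
  ... | s₁ , b←  , s₂ =
    circuit b (t₂ ++ h ∷ t₁) (Unique-resp-↭ (++-comm (h ∷ t₁) (b ∷ t₂)) u)
            (Linked-join s₂ (subst (λ x → Step x h) (final-++ h t₁ b t₂) h←) s₁)
            (subst (λ x → Step x b) (sym (final-++ b t₂ h t₁)) b←)
    , refl , final-++ b t₂ h t₁ , mk≈ (++-comm (b ∷ t₂) (h ∷ t₁))
      (trans (sumSteps-cycle crosses b t₂ h t₁)
            (trans (+-comm (crossings (b ∷ t₂) + crosses (final b t₂) h) _)
                   (sym (sumSteps-cycle crosses h t₁ b t₂))))

  rotateTo : ∀ {c vs ℓ u} → Traces c vs ℓ → u ∈ vs → Σ[ c′ ∈ Circuit ] first c′ ≡ u × Traces c′ vs ℓ
  rotateTo {c} tc u∈ with ∈-resp-↭ (↭-sym (Traces.vertices↭ tc)) u∈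
  ... | here refl = c , refl , tc
  ... | there u∈rest with ∈-∃++ u∈rest
  ...   | _ , _ , split with rotate c split
  ...     | c′ , b≡u , _ , c′≈c = c′ , b≡u , Traces-resp-≈ c′≈c tc

  rotateToLast : ∀ {c vs ℓ u} → Traces c vs ℓ → u ∈ vs → Σ[ c′ ∈ Circuit ] last c′ ≡ u × Traces c′ vs ℓ
  rotateToLast tc u∈ with rotateTo tc u∈
  ... | c′@(circuit _ [] _ _ _) , refl , tc′ = c′ , refl , tc′
  ... | c′@(circuit _ (b ∷ t) _ _ _) , refl , tc′ with rotate c′ {[]} {b} {t} refl
  ...   | c″ , _ , c″-ends-at-u , c″≈c′ = c″ , c″-ends-at-u , Traces-resp-≈ c″≈c′ tc′

  splice : (X Y : Circuit) → Disjoint (vertices X) (vertices Y) →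
           part (last X) ≡ part (last Y) ⊎ part (first X) ≡ part (first Y) →
           Step (last X) (first Y) → Step (last Y) (first X) →
           Σ[ Z ∈ Circuit ] Traces Z (vertices X ++ vertices Y) (weight X + weight Y)
  splice (circuit x xs ux sx _) (circuit y ys uy sy _) disjoint seam x→y y→x =
    circuit x (xs ++ y ∷ ys) (Unique.++⁺ ux uy disjoint) (Linked-join sx x→y sy)
            (subst (λ v → Step v x) (sym (final-++ x xs y ys)) y→x)
    , traces ↭-refl weight-spliced
    where
    open ≡.≡-Reasoning
    A = crossings (x ∷ xs)
    B = crossings (y ∷ ys)
    x′ = final x xs
    y′ = final y ys
    weight-spliced : crossings (x ∷ xs ++ y ∷ ys) + crosses (final x (xs ++ y ∷ ys)) x
                     ≡ (A + crosses x′ x) + (B + crosses y′ y)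
    weight-spliced = begin
      crossings (x ∷ xs ++ y ∷ ys) + crosses (final x (xs ++ y ∷ ys)) x
        ≡⟨ sumSteps-cycle crosses x xs y ys ⟩
      (A + crosses x′ y) + (B + crosses y′ x)  ≡⟨ interchange A (crosses x′ y) B (crosses y′ x) ⟩
      (A + B) + (crosses x′ y + crosses y′ x)  ≡⟨ cong ((A + B) +_) (crosses-exchange seam) ⟩
      (A + B) + (crosses x′ x + crosses y′ y)  ≡⟨ interchange A B (crosses x′ x) (crosses y′ y) ⟩
      (A + crosses x′ x) + (B + crosses y′ y)  ∎

  ArcPath : List⁺ (Fin n) → Set
  ArcPath P = Linked _⇒_ (toList P)

  Joined : List⁺ (Fin n) → List⁺ (Fin n) → Set
  Joined P Q = part (end P) ≡ part (L⁺.head Q)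

  Joined⇒lastJoined : ∀ {P Q} → Joined P Q → part (L⁺.last P) ≡ part (L⁺.head Q)
  Joined⇒lastJoined {P} = trans (cong part (last≡end P))

  lastJoined⇒Joined : ∀ {P Q} → part (L⁺.last P) ≡ part (L⁺.head Q) → Joined P Q
  lastJoined⇒Joined {P} = trans (cong part (sym (last≡end P)))

  pathLength : List⁺ (Fin n) → ℕ
  pathLength P = L⁺.length P ∸ 1

  flatten : ∀ {x xs} Ps {Q} → All ArcPath ((x ∷ xs) ∷ Ps) → Linked Joined ((x ∷ xs) ∷ Ps ++ [ Q ]) →
            let ys = xs ++ concat (map toList Ps) in
            Linked Step (x ∷ ys) × part (final x ys) ≡ part (L⁺.head Q)
            × crossings (x ∷ ys) ≡ sum (map pathLength ((x ∷ xs) ∷ Ps))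
  flatten {x} {xs} [] (arcs ∷ []) (joined ∷ [-]) rewrite ++-identityʳ xs =
    Linked.map arc arcs , joined , trans (sumSteps-Linked crosses crosses-arc arcs) (sym (+-identityʳ _))
  flatten {x} {xs} ((y ∷ ys) ∷ Ps) (arcs ∷ paths) (joined ∷ js) with flatten Ps paths js
  ... | steps , closes , count =
    Linked-join (Linked.map arc arcs) (gap joined) steps , trans (cong part (final-++ x xs y _)) closes ,
    trans (sumSteps-++ crosses x xs y _)
          (cong₂ _+_ (sumSteps-Linked crosses crosses-arc arcs) (cong₂ _+_ (crosses-gap joined) count))

  record Blocks (x : Fin n) (xs : List (Fin n)) : Set where
    constructor blocks
    field
      firstTail : List (Fin n)
      others    : List (List⁺ (Fin n))
      flat      : firstTail ++ concat (map toList others) ≡ xs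
      arcPaths  : All ArcPath ((x ∷ firstTail) ∷ others)
      joined    : Linked Joined ((x ∷ firstTail) ∷ others)
      ends      : end (final (x ∷ firstTail) others) ≡ final x xs
      count     : sum (map pathLength ((x ∷ firstTail) ∷ others)) ≡ crossings (x ∷ xs)

  splitAtGaps : ∀ {x xs} → Linked Step (x ∷ xs) → Blocks x xs
  splitAtGaps [-] = blocks [] [] refl ([-] ∷ []) [-] refl refl
  splitAtGaps {x} {y ∷ xs} (arc x⇒y ∷ l) with splitAtGaps l
  ... | blocks ft Ps flat (arcs ∷ paths) js ends count =
    blocks (y ∷ ft) Ps (cong (y ∷_) flat) ((x⇒y ∷ arcs) ∷ paths) (Linked-head (λ j → j) js)
           (trans (final-cong end Ps refl) ends)
           (trans (cong suc count) (cong (_+ crossings (y ∷ xs)) (sym (crosses-arc x⇒y))))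
  splitAtGaps {x} {y ∷ xs} (gap x∼y ∷ l) with splitAtGaps l
  ... | blocks ft Ps flat paths js ends count =
    blocks [] ((y ∷ ft) ∷ Ps) (cong (y ∷_) flat) ([-] ∷ paths) (x∼y ∷ js) ends
           (trans count (cong (_+ crossings (y ∷ xs)) (sym (crosses-gap x∼y))))

  pathsOf : ∀ Ps → Unique (concat (map toList Ps)) → All ArcPath Ps → All (IsPath D) Ps
  pathsOf []       _ []             = []
  pathsOf (P ∷ Ps) u (arcs ∷ paths) =
    let uP , uPs = Unique-++⁻ (toList P) u in (uP , arcs) ∷ pathsOf Ps uPs paths

  arcsOrGap : ∀ {x xs} → Linked Step (x ∷ xs) →
              Linked _⇒_ (x ∷ xs) ⊎ ∃₂ λ t₁ t₂ → ∃ λ y → xs ≡ t₁ ++ y ∷ t₂ × part (final x t₁) ≡ part y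
  arcsOrGap [-]         = inj₁ [-]
  arcsOrGap (gap e ∷ _) = inj₂ ([] , _ , _ , refl , e)
  arcsOrGap (arc r ∷ l) with arcsOrGap l
  ... | inj₁ arcs                    = inj₁ (r ∷ arcs)
  ... | inj₂ (t₁ , t₂ , y , refl , e) = inj₂ (_ ∷ t₁ , t₂ , y , refl , e)

  toCircuit : (C : GCycle D) → Σ[ c ∈ Circuit ] Traces c (V D C) (len D C)
  toCircuit (dircycle (x ∷ xs) (u , l)) with Linked-split xs l
  ... | arcs , back , _ =
    circuit x xs u (Linked.map arc arcs) (arc back) , traces ↭-refl (cycle-weight-arcs arcs back)
  toCircuit (pathseq ((x ∷ xs) ∷ Ps) (paths , u , js))
    with flatten Ps (All.map proj₂ paths) (Linked.map (λ {P} {Q} → lastJoined⇒Joined {P} {Q}) js)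
  ... | steps , closes , count =
    circuit x (xs ++ concat (map toList Ps)) u steps (gap closes)
    , traces ↭-refl (trans (cycle-weight-gap x (xs ++ concat (map toList Ps)) closes) count)

  toGCycle-gapClosed : (c : Circuit) → part (last c) ≡ part (first c) →
                       Σ[ C ∈ GCycle D ] Traces c (V D C) (len D C)
  toGCycle-gapClosed (circuit x _ u s _) closes with splitAtGaps s
  ... | blocks ft Ps refl arcs js ends count =
    pathseq ((x ∷ ft) ∷ Ps)
            (pathsOf ((x ∷ ft) ∷ Ps) u arcs , u ,
             Linked.map (λ {P} {Q} → Joined⇒lastJoined {P} {Q})
                        (Linked-join js (trans (cong part ends) closes) [-]))
    , traces ↭-refl (trans (cycle-weight-gap x (ft ++ concat (map toList Ps)) closes) (sym count))

  toGCycle : (c : Circuit) → Σ[ C ∈ GCycle D ] Traces c (V D C) (len D C)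
  toGCycle c@(circuit _ _ _ _ (gap closes)) = toGCycle-gapClosed c closes
  toGCycle c@(circuit x xs u s (arc back)) with arcsOrGap s
  ... | inj₁ arcs =
    dircycle (x ∷ xs) (u , Linked-join arcs back [-]) , traces ↭-refl (cycle-weight-arcs arcs back)
  ... | inj₂ (t₁ , t₂ , y , split , x′∼y) with rotate c split
  ...   | c′ , refl , ends , c′≈c with toGCycle-gapClosed c′ (trans (cong part ends) x′∼y)
  ...     | C , c′-traces-C = C , Traces-resp-≈ (≈-sym c′≈c) c′-traces-C

  LongSpanningGCycle : GCycle D → GCycle D → Set
  LongSpanningGCycle C₁ C₂ = ∃ λ (C : GCycle D) → Spanning D C × len D C ≥ len D C₁ + len D C₂

  LongSpanningGCycle-comm : ∀ C₁ C₂ → LongSpanningGCycle C₂ C₁ → LongSpanningGCycle C₁ C₂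
  LongSpanningGCycle-comm C₁ C₂ (C , spanning , long) =
    C , spanning , subst (len D C ≥_) (+-comm (len D C₂) (len D C₁)) long

  IsFactor₂-sym : ∀ C₁ C₂ → IsFactor₂ D C₁ C₂ → IsFactor₂ D C₂ C₁
  IsFactor₂-sym _ _ (disjoint , covers) = (λ v p q → disjoint v q p) , (λ v → Sum.swap (covers v))

  module TwoCycleFactor (C₁ C₂ : GCycle D) (factor : IsFactor₂ D C₁ C₂) where

    splice-spanning : ∀ {X Y} → Traces X (V D C₁) (len D C₁) → Traces Y (V D C₂) (len D C₂) →
                      part (last X) ≡ part (last Y) ⊎ part (first X) ≡ part (first Y) →
                      Step (last X) (first Y) → Step (last Y) (first X) → LongSpanningGCycle C₁ C₂
    splice-spanning {X} {Y} (traces X↭ wX) (traces Y↭ wY) seam x→y y→x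
      with splice X Y (λ (p , q) → proj₁ factor _ (∈-resp-↭ X↭ p) (∈-resp-↭ Y↭ q)) seam x→y y→x
    ... | Z , traces Z↭ wZ with toGCycle Z
    ...   | C , traces Z↭C wC = C , spanning , ≤-reflexive long
      where
      spanning : Spanning D C
      spanning v = ∈-resp-↭ (↭-trans (↭-sym (++⁺ X↭ Y↭)) (↭-trans (↭-sym Z↭) Z↭C))
                            ([ ∈-++⁺ˡ , ∈-++⁺ʳ (V D C₁) ]′ (proj₂ factor v))
      long : len D C₁ + len D C₂ ≡ len D C
      long = trans (sym (cong₂ _+_ wX wY)) (trans (sym wZ) wC)

    -- Each failed splice exhibits an arc refuting one of the singularities, so no decision
    -- procedure for singularity is needed.
    spliceAfter : ∀ {a b} → a ∈ V D C₁ → b ∈ V D C₂ →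
                  LongSpanningGCycle C₁ C₂ ⊎ ¬ (OutSingular D C₂ a × OutSingular D C₁ b)
    spliceAfter a∈ b∈ with rotateToLast (proj₂ (toCircuit C₁)) a∈ | rotateToLast (proj₂ (toCircuit C₂)) b∈
    ... | X , refl , tX | Y , refl , tY
      with step? (last X) (first Y) | step? (last Y) (first X) | part (last X) ≟ part (last Y)
    ... | inj₂ y⇒a | _ | _ = inj₂ λ (a-out , _) → proj₂ a-out (first Y) (first∈ tY) y⇒a
    ... | inj₁ _ | inj₂ x⇒b | _ = inj₂ λ (_ , b-out) → proj₂ b-out (first X) (first∈ tX) x⇒b
    ... | inj₁ _ | inj₁ _ | no a≁b =
      inj₂ λ (a-out , b-out) → a≁b (nonadjacent⇒samePart (proj₂ b-out _ a∈) (proj₂ a-out _ b∈))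
    ... | inj₁ a→y | inj₁ b→x | yes a∼b = inj₁ (splice-spanning tX tY (inj₁ a∼b) a→y b→x)

    spliceBefore : ∀ {a b} → a ∈ V D C₁ → b ∈ V D C₂ →
                   LongSpanningGCycle C₁ C₂ ⊎ ¬ (InSingular D C₂ a × InSingular D C₁ b)
    spliceBefore a∈ b∈ with rotateTo (proj₂ (toCircuit C₁)) a∈ | rotateTo (proj₂ (toCircuit C₂)) b∈
    ... | X , refl , tX | Y , refl , tY
      with step? (last X) (first Y) | step? (last Y) (first X) | part (first X) ≟ part (first Y)
    ... | inj₂ b⇒x | _ | _ = inj₂ λ (_ , b-in) → proj₂ b-in (last X) (last∈ tX) b⇒x
    ... | inj₁ _ | inj₂ a⇒y | _ = inj₂ λ (a-in , _) → proj₂ a-in (last Y) (last∈ tY) a⇒y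
    ... | inj₁ _ | inj₁ _ | no a≁b =
      inj₂ λ (a-in , b-in) → a≁b (nonadjacent⇒samePart (proj₂ a-in _ b∈) (proj₂ b-in _ a∈))
    ... | inj₁ x→b | inj₁ y→a | yes a∼b = inj₁ (splice-spanning tX tY (inj₂ a∼b) x→b y→a)

    fromOutSingulars : ∀ {a b} → a ∈ V D C₁ → b ∈ V D C₂ → OutSingular D C₂ a → OutSingular D C₁ b →
                       LongSpanningGCycle C₁ C₂
    fromOutSingulars a∈ b∈ a-out b-out = Sum.fromInj₁ (contradiction (a-out , b-out)) (spliceAfter a∈ b∈)

    fromInSingulars : ∀ {a b} → a ∈ V D C₁ → b ∈ V D C₂ → InSingular D C₂ a → InSingular D C₁ b →
                      LongSpanningGCycle C₁ C₂
    fromInSingulars a∈ b∈ a-in b-in = Sum.fromInj₁ (contradiction (a-in , b-in)) (spliceBefore a∈ b∈)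

    outSingularOnly : ∀ {b x} → b ∈ V D C₂ → InSingular D C₁ b → x ∈ V D C₁ →
                      LongSpanningGCycle C₁ C₂ ⊎ (Singular D C₂ x → OutSingular D C₂ x)
    outSingularOnly b∈ b-in x∈ =
      Sum.map₂ (λ ¬both → [ (λ x-out → x-out) , (λ x-in → contradiction (x-in , b-in) ¬both) ]′)
               (spliceBefore x∈ b∈)

    inSingularOnly : ∀ {a y} → a ∈ V D C₁ → OutSingular D C₂ a → y ∈ V D C₂ →
                     LongSpanningGCycle C₁ C₂ ⊎ (Singular D C₁ y → InSingular D C₁ y)
    inSingularOnly a∈ a-out y∈ =
      Sum.map₂ (λ ¬both → [ (λ y-out → contradiction (a-out , y-out) ¬both) , (λ y-in → y-in) ]′)
               (spliceAfter a∈ y∈)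

    fromOutInSingulars : ∀ {a b} → a ∈ V D C₁ → OutSingular D C₂ a → b ∈ V D C₂ → InSingular D C₁ b →
                         ¬ (_≃>_ D C₁ C₂) → LongSpanningGCycle C₁ C₂
    fromOutInSingulars {a} {b} a∈ a-out b∈ b-in ¬C₁≃>C₂
      with forEach (V D C₁) (outSingularOnly b∈ b-in) | forEach (V D C₂) (inSingularOnly a∈ a-out)
    ... | inj₁ long | _         = long
    ... | inj₂ _    | inj₁ long = long
    ... | inj₂ outs | inj₂ ins  =
      contradiction ((a , a∈ , inj₁ a-out) , outs , (b , b∈ , inj₂ b-in) , ins) ¬C₁≃>C₂

lemma7p5 : (D : SMD) (C₁ C₂ : GCycle D) →
    IsFactor₂ D C₁ C₂ →
    HasSingular D C₁ C₂ →
    HasSingular D C₂ C₁ →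
    ¬ (_≃>_ D C₁ C₂) →
    ¬ (_≃>_ D C₂ C₁) →
    ∃ λ (C : GCycle D) → Spanning D C × len D C ≥ len D C₁ + len D C₂
lemma7p5 D C₁ C₂ factor (a , a∈ , a-sing) (b , b∈ , b-sing) ¬C₁≃>C₂ ¬C₂≃>C₁ =
  case a-sing , b-sing of λ where
    (inj₁ a-out , inj₁ b-out) → fromOutSingulars a∈ b∈ a-out b-out
    (inj₂ a-in  , inj₂ b-in)  → fromInSingulars a∈ b∈ a-in b-in
    (inj₁ a-out , inj₂ b-in)  → fromOutInSingulars a∈ a-out b∈ b-in ¬C₁≃>C₂
    (inj₂ a-in  , inj₁ b-out) →
      LongSpanningGCycle-comm D C₁ C₂ (Swapped.fromOutInSingulars b∈ b-out a∈ a-in ¬C₂≃>C₁)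
  where
  open TwoCycleFactor D C₁ C₂ factor
  module Swapped = TwoCycleFactor D C₂ C₁ (IsFactor₂-sym D C₁ C₂ factor)
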